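{- Let $G$ be a maximal outerplanar graph with $n\ge 7$ vertices. Then exactly one of the following holds: (1) there exist two independent edges $e_1,e_2\in E(G)$ (i.e. sharing no endpoint) which are both 2-chords of $G$; (2) $G$ is isomorphic to $K_1+P_{n-1}$.
   Context: A maximal outerplanar graph $G$ of order $n\ge 3$ is represented by an $n$-cycle $C_n$ (the boundary of the outer face), with vertices $v_1,\dots,v_n$ in cyclic order, whose interior is triangulated by non-crossing chords. For an edge of $G$ not in $C_n$, its endpoints split $C_n$ into two paths; if the shorter of these has length $i$, the edge is called an $i$-chord. $P_{n-1}$ denotes the path on $n-1$ vertices, and $K_1+P_{n-1}$ is the join: a path on $n-1$ vertices plus one extra vertex adjacent to all of them. -}

module Defs where

open import Data.Nat using (ℕ; zero; suc; _∸_; _≤_; _<_; _⊓_; _⊔_; ∣_-_∣)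
open import Data.Fin using (Fin; toℕ)
open import Data.Bool using (Bool; true; false)
open import Data.Product using (Σ; _×_; ∃)
open import Data.Sum using (_⊎_)
open import Relation.Binary.PropositionalEquality using (_≡_; _≢_)
open import Relation.Nullary using (¬_)
open import Function.Bundles using (_↔_; _⇔_; Inverse)

-- Cyclic distance on the n-cycle v_0,...,v_{n-1} (vertex v_{k+1} of the
-- paper is index k): length of the shorter of the two boundary paths.
cdist : (n : ℕ) → Fin n → Fin n → ℕ
cdist n i j = ∣ toℕ i - toℕ j ∣ ⊓ (n ∸ ∣ toℕ i - toℕ j ∣)

Inside : {n : ℕ} → Fin n → Fin n → Fin n → Set
Inside i j x = (toℕ i ⊓ toℕ j) < toℕ x × toℕ x < (toℕ i ⊔ toℕ j)

Outside : {n : ℕ} → Fin n → Fin n → Fin n → Set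
Outside i j x = toℕ x < (toℕ i ⊓ toℕ j) ⊎ (toℕ i ⊔ toℕ j) < toℕ x

Crosses : {n : ℕ} → Fin n → Fin n → Fin n → Fin n → Set
Crosses i j c d = (Inside i j c × Outside i j d) ⊎ (Inside i j d × Outside i j c)

-- A maximal outerplanar graph of order n, represented (as in the paper)
-- by its boundary n-cycle (vertices in cyclic order 0,1,...,n-1) whose
-- interior is triangulated by non-crossing chords: all cycle edges are
-- present, no two edges cross, and the chord set is maximal (every
-- missing pair of distinct vertices would cross an existing edge).
record MOP (n : ℕ) : Set where
  field
    order≥3     : 3 ≤ n
    adj         : Fin n → Fin n → Bool
    adj-sym     : ∀ i j → adj i j ≡ adj j i
    adj-irrefl  : ∀ i → adj i i ≡ false
    cycle       : ∀ i j → cdist n i j ≡ 1 → adj i j ≡ true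
    noncrossing : ∀ i j c d → adj i j ≡ true → adj c d ≡ true → ¬ Crosses i j c d
    maximal     : ∀ i j → i ≢ j → adj i j ≡ false →
                  Σ (Fin n) λ c → Σ (Fin n) λ d → adj c d ≡ true × Crosses i j c d

Adj : {n : ℕ} → MOP n → Fin n → Fin n → Set
Adj G i j = MOP.adj G i j ≡ true

-- the edge i–j of G is a 2-chord (for n ≥ 5 cyclic distance 2 already
-- excludes cycle edges)
TwoChord : {n : ℕ} → MOP n → Fin n → Fin n → Set
TwoChord {n} G i j = Adj G i j × cdist n i j ≡ 2

TwoIndependentTwoChords : {n : ℕ} → MOP n → Set
TwoIndependentTwoChords {n} G =
  Σ (Fin n) λ a → Σ (Fin n) λ b → Σ (Fin n) λ c → Σ (Fin n) λ d →
    TwoChord G a b × TwoChord G c d ×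
    a ≢ c × a ≢ d × b ≢ c × b ≢ d

-- K_1 + P_{n-1} on vertex set Fin n: vertex 0 is the K_1 (adjacent to all
-- others), vertices 1,...,n-1 form the path 1 - 2 - ... - (n-1).
Hub : {n : ℕ} → Fin n → Fin n → Set
Hub i j = toℕ i ≡ 0 × 1 ≤ toℕ j

PathEdge : {n : ℕ} → Fin n → Fin n → Set
PathEdge i j = 1 ≤ toℕ i × toℕ j ≡ suc (toℕ i)

FanAdj : {n : ℕ} → Fin n → Fin n → Set
FanAdj i j = Hub i j ⊎ Hub j i ⊎ PathEdge i j ⊎ PathEdge j i

IsoFan : {n : ℕ} → MOP n → Set
IsoFan {n} G = Σ (Fin n ↔ Fin n) λ f →
  ∀ i j → (Adj G i j ⇔ FanAdj (Inverse.to f i) (Inverse.to f j))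

{-# OPTIONS --safe #-}
module Submission where

-- Vertices are 0, …, n − 1 and the triangle on the boundary edge 0–(n − 1) has an apex c.
-- Inside the polygon cut off by a chord i–j, either some 2-chord t–(t + 2) lies between i and j
-- and avoids a prescribed end of the chord, or that end is adjacent to every vertex from i to j.
-- Applying this on both sides of the apex (when c is 1 or n − 2, the chord c–(n − 1) resp. 0–c is
-- itself a 2-chord around the corner) produces two 2-chords at distance at least 3 along the
-- boundary, hence independent, unless some vertex is adjacent to all others; rotating that vertex
-- to 0 exhibits G as K₁ + P_{n−1}. Conversely the middle vertex of a 2-chord is adjacent only to
-- the chord's ends, so in a fan, whose centre sees every vertex, each 2-chord contains the centre.

open import Defs
open import Data.Nat
open import Data.Nat.Properties
open import Data.Fin as Fin using (Fin; toℕ; fromℕ<; #_)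
open import Data.Fin.Properties using (toℕ-fromℕ<; fromℕ<-toℕ; fromℕ<-injective; toℕ-injective; toℕ<n)
import Data.Bool as Bool
open import Data.Bool.Properties using (¬-not)
open import Data.Product
open import Data.Sum
open import Data.Empty
open import Relation.Nullary
open import Relation.Nullary.Decidable using (map′)
open import Relation.Binary.PropositionalEquality
open import Relation.Binary.Definitions using (tri<; tri≈; tri>)
open import Function using (_∘_)
open import Function.Bundles

Crossesℕ : ℕ → ℕ → ℕ → ℕ → Set
Crossesℕ a b c d = ((a < c × c < b) × (d < a ⊎ b < d)) ⊎ ((a < d × d < b) × (c < a ⊎ b < c))

-- Crosses i j c d is definitionally Crossesℕ (toℕ i ⊓ toℕ j) (toℕ i ⊔ toℕ j) (toℕ c) (toℕ d).
module _ {n : ℕ} {i j c d : Fin n} (i≤j : toℕ i ≤ toℕ j) where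

  Crosses⇒Crossesℕ : Crosses i j c d → Crossesℕ (toℕ i) (toℕ j) (toℕ c) (toℕ d)
  Crosses⇒Crossesℕ = subst₂ (λ lo hi → Crossesℕ lo hi (toℕ c) (toℕ d))
                            (m≤n⇒m⊓n≡m i≤j) (m≤n⇒m⊔n≡n i≤j)

  Crossesℕ⇒Crosses : Crossesℕ (toℕ i) (toℕ j) (toℕ c) (toℕ d) → Crosses i j c d
  Crossesℕ⇒Crosses = subst₂ (λ lo hi → Crossesℕ lo hi (toℕ c) (toℕ d))
                            (sym (m≤n⇒m⊓n≡m i≤j)) (sym (m≤n⇒m⊔n≡n i≤j))

∣m-n+m∣≡n : ∀ m n → ∣ m - n + m ∣ ≡ n
∣m-n+m∣≡n m n = trans (m≤n⇒∣m-n∣≡n∸m (m≤n+m m n)) (m+n∸n≡m n m)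

squeeze : ∀ {a b} → a < b → ¬ (2 + a ≤ b) → b ≡ suc a
squeeze a<b ¬a+2≤b = ≤-antisym (≤-pred (≰⇒> ¬a+2≤b)) a<b

avoid-two : ∀ {k} (p q : Fin (4 + k)) → Σ (Fin (4 + k)) λ u → 1 ≤ toℕ u × u ≢ p × u ≢ q
avoid-two p q with # 1 Fin.≟ p | # 1 Fin.≟ q | # 2 Fin.≟ p | # 2 Fin.≟ q
... | no 1≢p | no 1≢q | _ | _ = _ , s≤s z≤n , 1≢p , 1≢q
... | _ | _ | no 2≢p | no 2≢q = _ , s≤s z≤n , 2≢p , 2≢q
... | yes refl | _ | _ | yes refl = # 3 , s≤s z≤n , (λ ()) , (λ ())
... | _ | yes refl | yes refl | _ = # 3 , s≤s z≤n , (λ ()) , (λ ())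
... | yes refl | _ | yes () | _
... | _ | yes refl | _ | yes ()

module Rotation {n h : ℕ} (h<n : h < n) where

  shift : ℕ → ℕ
  shift v with h ≤? v
  ... | yes _ = v ∸ h
  ... | no _ = v + n ∸ h

  unshift : ℕ → ℕ
  unshift u with n ≤? u + h
  ... | yes _ = u + h ∸ n
  ... | no _ = u + h

  shift-spec : ∀ v → (h ≤ v × shift v + h ≡ v) ⊎ (v < h × shift v + h ≡ v + n)
  shift-spec v with h ≤? v
  ... | yes h≤v = inj₁ (h≤v , m∸n+n≡m h≤v)
  ... | no h≰v = inj₂ (≰⇒> h≰v , m∸n+n≡m (≤-trans (<⇒≤ h<n) (m≤n+m n v)))

  unshift-spec : ∀ u → (n ≤ u + h × unshift u + n ≡ u + h) ⊎ (u + h < n × unshift u ≡ u + h)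
  unshift-spec u with n ≤? u + h
  ... | yes n≤u+h = inj₁ (n≤u+h , m∸n+n≡m n≤u+h)
  ... | no n≰u+h = inj₂ (≰⇒> n≰u+h , refl)

  shift<n : ∀ {v} → v < n → shift v < n
  shift<n {v} v<n with shift-spec v
  ... | inj₁ (_ , e) = ≤-<-trans (m≤m+n (shift v) h) (subst (_< n) (sym e) v<n)
  ... | inj₂ (v<h , e) = +-cancelʳ-< h (shift v) n (subst₂ _<_ (sym e) (+-comm h n) (+-monoˡ-< n v<h))

  unshift<n : ∀ {u} → u < n → unshift u < n
  unshift<n {u} u<n with unshift-spec u
  ... | inj₁ (_ , e) = +-cancelʳ-< n (unshift u) n (subst (_< n + n) (sym e) (+-mono-< u<n h<n))
  ... | inj₂ (u+h<n , e) = subst (_< n) (sym e) u+h<n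

  unshift-shift : ∀ {v} → v < n → unshift (shift v) ≡ v
  unshift-shift {v} v<n with shift-spec v | unshift-spec (shift v)
  ... | inj₁ (_ , e) | inj₁ (n≤ , _) = ⊥-elim (<⇒≱ v<n (subst (n ≤_) e n≤))
  ... | inj₁ (_ , e) | inj₂ (_ , e′) = trans e′ e
  ... | inj₂ (_ , e) | inj₁ (_ , e′) = +-cancelʳ-≡ n _ _ (trans e′ e)
  ... | inj₂ (_ , e) | inj₂ (<n , _) = ⊥-elim (<⇒≱ (subst (_< n) e <n) (m≤n+m n v))

  shift-unshift : ∀ {u} → u < n → shift (unshift u) ≡ u
  shift-unshift {u} u<n with unshift-spec u | shift-spec (unshift u)
  ... | inj₁ (_ , e) | inj₁ (h≤ , _) =
    ⊥-elim (<⇒≱ u<n (+-cancelʳ-≤ h n u (subst₂ _≤_ (+-comm h n) e (+-monoˡ-≤ n h≤))))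
  ... | inj₁ (_ , e) | inj₂ (_ , e′) = +-cancelʳ-≡ h _ _ (trans e′ e)
  ... | inj₂ (_ , e) | inj₁ (_ , e′) = +-cancelʳ-≡ h _ _ (trans e′ e)
  ... | inj₂ (_ , e) | inj₂ (<h , _) = ⊥-elim (<⇒≱ (subst (_< h) e <h) (m≤n+m h u))

  shift-h : shift h ≡ 0
  shift-h with shift-spec h
  ... | inj₁ (_ , e) = +-cancelʳ-≡ h _ 0 e
  ... | inj₂ (h<h , _) = ⊥-elim (<-irrefl refl h<h)

  shift≡0⇒≡h : ∀ {v} → v < n → shift v ≡ 0 → v ≡ h
  shift≡0⇒≡h {v} v<n s≡0 with shift-spec v
  ... | inj₁ (_ , e) = trans (sym e) (cong (_+ h) s≡0)
  ... | inj₂ (_ , e) = ⊥-elim (<⇒≱ h<n (subst (n ≤_) (trans (sym e) (cong (_+ h) s≡0)) (m≤n+m n v)))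

  shift-pos : ∀ {v} → v < n → v ≢ h → 1 ≤ shift v
  shift-pos v<n v≢h = n≢0⇒n>0 (v≢h ∘ shift≡0⇒≡h v<n)

  shift-suc : ∀ {v} → suc v ≢ h → shift (suc v) ≡ suc (shift v)
  shift-suc {v} v+1≢h with shift-spec v | shift-spec (suc v)
  ... | inj₁ (_ , e) | inj₁ (_ , e′) = +-cancelʳ-≡ h _ _ (trans e′ (cong suc (sym e)))
  ... | inj₁ (h≤v , _) | inj₂ (v+1<h , _) = ⊥-elim (<⇒≱ (<-trans (n<1+n v) v+1<h) h≤v)
  ... | inj₂ (v<h , _) | inj₁ (h≤v+1 , _) = ⊥-elim (v+1≢h (≤-antisym v<h h≤v+1))
  ... | inj₂ (_ , e) | inj₂ (_ , e′) = +-cancelʳ-≡ h _ _ (trans e′ (cong suc (sym e)))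

  shift-wrap : ∀ {v} → suc v ≡ n → h ≢ 0 → h ≢ v → shift 0 ≡ suc (shift v)
  shift-wrap {v} v+1≡n h≢0 h≢v with shift-spec 0 | shift-spec v
  ... | inj₁ (h≤0 , _) | _ = ⊥-elim (h≢0 (≤-antisym h≤0 z≤n))
  ... | _ | inj₂ (v<h , _) = ⊥-elim (h≢v (≤-antisym (≤-pred (subst (h <_) (sym v+1≡n) h<n)) (<⇒≤ v<h)))
  ... | inj₂ (_ , e) | inj₁ (_ , e′) =
    +-cancelʳ-≡ h _ _ (trans e (trans (sym v+1≡n) (cong suc (sym e′))))

  shift-suc⁻¹ : ∀ {v w} → v < n → w < n → shift w ≡ suc (shift v) → w ≡ suc v ⊎ (suc v ≡ n × w ≡ 0)
  shift-suc⁻¹ {v} {w} v<n w<n eq with shift-spec v | shift-spec w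
  ... | inj₁ (_ , e) | inj₁ (_ , e′) = inj₁ (trans (sym e′) (trans (cong (_+ h) eq) (cong suc e)))
  ... | inj₂ (_ , e) | inj₂ (_ , e′) =
    inj₁ (+-cancelʳ-≡ n _ _ (trans (sym e′) (trans (cong (_+ h) eq) (cong suc e))))
  ... | inj₂ (_ , e) | inj₁ (_ , e′) = ⊥-elim (<⇒≱ w<n (<⇒≤ (subst (n <_) w≡v+1+n (s≤s (m≤n+m n v)))))
    where w≡v+1+n = trans (sym (cong suc e)) (trans (sym (cong (_+ h) eq)) e′)
  ... | inj₁ (_ , e) | inj₂ (_ , e′) = wrapped w (trans (sym e′) (trans (cong (_+ h) eq) (cong suc e)))
    where
    wrapped : ∀ w → w + n ≡ suc v → w ≡ suc v ⊎ (suc v ≡ n × w ≡ 0)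
    wrapped zero n≡v+1 = inj₂ (sym n≡v+1 , refl)
    wrapped (suc w) w+1+n≡v+1 = ⊥-elim (<⇒≱ v<n (subst (n ≤_) (suc-injective w+1+n≡v+1) (m≤n+m n w)))

  rotation : Fin n ↔ Fin n
  rotation = mk↔ₛ′ to from to-from from-to
    where
    to from : Fin n → Fin n
    to v = fromℕ< (shift<n (toℕ<n v))
    from u = fromℕ< (unshift<n (toℕ<n u))
    to-from : ∀ u → to (from u) ≡ u
    to-from u = toℕ-injective (begin
      toℕ (to (from u))        ≡⟨ toℕ-fromℕ< _ ⟩
      shift (toℕ (from u))     ≡⟨ cong shift (toℕ-fromℕ< _) ⟩
      shift (unshift (toℕ u))  ≡⟨ shift-unshift (toℕ<n u) ⟩
      toℕ u                    ∎)
      where open ≡-Reasoning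
    from-to : ∀ v → from (to v) ≡ v
    from-to v = toℕ-injective (begin
      toℕ (from (to v))        ≡⟨ toℕ-fromℕ< _ ⟩
      unshift (toℕ (to v))     ≡⟨ cong unshift (toℕ-fromℕ< _) ⟩
      unshift (shift (toℕ v))  ≡⟨ unshift-shift (toℕ<n v) ⟩
      toℕ v                    ∎)
      where open ≡-Reasoning

  toℕ-rotation : ∀ v → toℕ (Inverse.to rotation v) ≡ shift (toℕ v)
  toℕ-rotation v = toℕ-fromℕ< _

module Boundary {m : ℕ} (G : MOP (suc m)) where
  open MOP G

  n : ℕ
  n = suc m

  Edge : ℕ → ℕ → Set
  Edge a b = Σ (a < n) λ a<n → Σ (b < n) λ b<n → Adj G (fromℕ< a<n) (fromℕ< b<n)

  edge-sym : ∀ {a b} → Edge a b → Edge b a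
  edge-sym (a<n , b<n , e) = b<n , a<n , trans (adj-sym _ _) e

  edge-irrefl : ∀ {a} → ¬ Edge a a
  edge-irrefl (a<n , _ , e) with trans (sym e) (adj-irrefl (fromℕ< a<n))
  ... | ()

  source<n : ∀ {a b} → Edge a b → a < n
  source<n = proj₁

  target<n : ∀ {a b} → Edge a b → b < n
  target<n = proj₁ ∘ proj₂

  Adj⇒Edge : ∀ {i j} → Adj G i j → Edge (toℕ i) (toℕ j)
  Adj⇒Edge {i} {j} e = toℕ<n i , toℕ<n j ,
    subst₂ (Adj G) (sym (fromℕ<-toℕ i (toℕ<n i))) (sym (fromℕ<-toℕ j (toℕ<n j))) e

  Edge⇒Adj : ∀ {i j} → Edge (toℕ i) (toℕ j) → Adj G i j
  Edge⇒Adj {i} {j} (p , q , e) = subst₂ (Adj G) (fromℕ<-toℕ i p) (fromℕ<-toℕ j q) e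

  edge? : ∀ a b → a < n → b < n → Dec (Edge a b)
  edge? a b a<n b<n =
    map′ (λ e → a<n , b<n , e) (λ (_ , _ , e) → e) (adj (fromℕ< a<n) (fromℕ< b<n) Bool.≟ Bool.true)

  no-crossing : ∀ {a b c d} → Edge a b → Edge c d → a < c → c < b → d < a ⊎ b < d → ⊥
  no-crossing {a} {b} {c} {d} (pa , pb , e) (pc , pd , e') a<c c<b d-out =
    noncrossing _ _ _ _ e e' (Crossesℕ⇒Crosses a≤b crossing)
    where
    a≤b : toℕ (fromℕ< pa) ≤ toℕ (fromℕ< pb)
    a≤b rewrite toℕ-fromℕ< pa | toℕ-fromℕ< pb = <⇒≤ (<-trans a<c c<b)
    crossing : Crossesℕ (toℕ (fromℕ< pa)) (toℕ (fromℕ< pb)) (toℕ (fromℕ< pc)) (toℕ (fromℕ< pd))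
    crossing rewrite toℕ-fromℕ< pa | toℕ-fromℕ< pb | toℕ-fromℕ< pc | toℕ-fromℕ< pd =
      inj₁ ((a<c , c<b) , d-out)

  missing-edge-crossed : ∀ {a b} → a < b → b < n → ¬ Edge a b →
                         Σ ℕ λ c → Σ ℕ λ d → Edge c d × Crossesℕ a b c d
  missing-edge-crossed {a} {b} a<b b<n ¬e =
    crossing (maximal (fromℕ< a<n) (fromℕ< b<n) a≢b (¬-not λ e → ¬e (a<n , b<n , e)))
    where
    a<n = <-trans a<b b<n
    a≢b : fromℕ< a<n ≢ fromℕ< b<n
    a≢b eq = <⇒≢ a<b (trans (sym (toℕ-fromℕ< a<n)) (trans (cong toℕ eq) (toℕ-fromℕ< b<n)))
    a≤b : toℕ (fromℕ< a<n) ≤ toℕ (fromℕ< b<n)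
    a≤b rewrite toℕ-fromℕ< a<n | toℕ-fromℕ< b<n = <⇒≤ a<b
    crossing : Σ (Fin n) (λ c → Σ (Fin n) λ d → Adj G c d × Crosses (fromℕ< a<n) (fromℕ< b<n) c d) →
               Σ ℕ λ c → Σ ℕ λ d → Edge c d × Crossesℕ a b c d
    crossing (c , d , e , cr) = toℕ c , toℕ d , Adj⇒Edge e ,
      subst₂ (λ x y → Crossesℕ x y (toℕ c) (toℕ d)) (toℕ-fromℕ< a<n) (toℕ-fromℕ< b<n)
        (Crosses⇒Crossesℕ a≤b cr)

  cdistℕ : ℕ → ℕ → ℕ
  cdistℕ a b = ∣ a - b ∣ ⊓ (n ∸ ∣ a - b ∣)

  cdist-fromℕ< : ∀ {a b} (a<n : a < n) (b<n : b < n) →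
                 cdist n (fromℕ< a<n) (fromℕ< b<n) ≡ cdistℕ a b
  cdist-fromℕ< a<n b<n = cong₂ cdistℕ (toℕ-fromℕ< a<n) (toℕ-fromℕ< b<n)

  1≤m : 1 ≤ m
  1≤m = ≤-pred (≤-trans (s≤s (s≤s z≤n)) order≥3)

  cycle-edge : ∀ {a} → suc a < n → Edge a (suc a)
  cycle-edge {a} sa<n = a<n , sa<n , cycle _ _ (trans (cdist-fromℕ< a<n sa<n) unit)
    where
    a<n = <-trans (n<1+n a) sa<n
    unit : cdistℕ a (suc a) ≡ 1
    unit rewrite ∣m-n+m∣≡n a 1 = m≤n⇒m⊓n≡m 1≤m

  closing-edge : Edge 0 m
  closing-edge = s≤s z≤n , ≤-refl , cycle _ _ (trans (cdist-fromℕ< (s≤s z≤n) ≤-refl) unit)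
    where
    unit : cdistℕ 0 m ≡ 1
    unit rewrite m+n∸n≡m 1 m = m≥n⇒m⊓n≡n 1≤m

  NoEdgeBetween : ℕ → ℕ → ℕ → Set
  NoEdgeBetween i lo hi = ∀ s → lo < s → s < hi → ¬ Edge i s

  farthest-neighbour : ∀ {i j} b → Edge i j → i < b → b < j → NoEdgeBetween i b j →
                       Σ ℕ λ c → i < c × c < j × Edge i c × NoEdgeBetween i c j
  farthest-neighbour {i} {j} b eij i<b b<j none
    with edge? i b (source<n eij) (<-trans b<j (target<n eij))
  ... | yes eib = b , i<b , b<j , eib , none
  farthest-neighbour {i} {j} (suc b) eij i<b b<j none | no ¬eib with i ≟ b
  ... | yes refl = ⊥-elim (¬eib (cycle-edge (<-trans b<j (target<n eij))))
  ... | no i≢b = farthest-neighbour b eij (≤∧≢⇒< (≤-pred i<b) i≢b) (<-trans (n<1+n b) b<j) none′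
    where
    none′ : NoEdgeBetween i b j
    none′ s b<s s<j with s ≟ suc b
    ... | yes refl = ¬eib
    ... | no s≢sb = none s (≤∧≢⇒< b<s (s≢sb ∘ sym)) s<j

  triangle-apex : ∀ {i j} → 2 + i ≤ j → Edge i j → Σ ℕ λ c → i < c × c < j × Edge i c × Edge c j
  triangle-apex {i} {suc j} (s≤s i<j) eij
    with farthest-neighbour j eij i<j ≤-refl (λ s j<s s<sj _ → <⇒≱ j<s (≤-pred s<sj))
  ... | c , i<c , c<sj , eic , none = c , i<c , c<sj , eic , ecj
    where
    blocked : ∀ x y → Edge x y → c < x → x < suc j → y < c ⊎ suc j < y → ⊥
    blocked x y exy c<x x<sj (inj₂ sj<y) = no-crossing eij exy (<-trans i<c c<x) x<sj (inj₂ sj<y)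
    blocked x y exy c<x x<sj (inj₁ y<c) with <-cmp y i
    ... | tri< y<i _ _ = no-crossing eij exy (<-trans i<c c<x) x<sj (inj₁ y<i)
    ... | tri≈ _ refl _ = none x c<x x<sj (edge-sym exy)
    ... | tri> _ _ i<y = no-crossing eic (edge-sym exy) i<y y<c (inj₂ c<x)
    ecj : Edge c (suc j)
    ecj with edge? c (suc j) (target<n eic) (target<n eij)
    ... | yes e = e
    ... | no ¬e with missing-edge-crossed c<sj (target<n eij) ¬e
    ...   | x , y , exy , inj₁ ((c<x , x<sj) , y-out) = ⊥-elim (blocked x y exy c<x x<sj y-out)
    ...   | x , y , exy , inj₂ ((c<y , y<sj) , x-out) =
      ⊥-elim (blocked y x (edge-sym exy) c<y y<sj x-out)

  TwoChordAt : ℕ → Set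
  TwoChordAt t = Edge t (2 + t)

  TwoChordIn : ℕ → ℕ → Set
  TwoChordIn lo hi = Σ ℕ λ t → lo ≤ t × 2 + t ≤ hi × TwoChordAt t

  TwoChordIn-mono : ∀ {lo lo′ hi hi′} → lo′ ≤ lo → hi ≤ hi′ → TwoChordIn lo hi → TwoChordIn lo′ hi′
  TwoChordIn-mono lo′≤lo hi≤hi′ (t , lo≤t , t+2≤hi , ch) =
    t , ≤-trans lo′≤lo lo≤t , ≤-trans t+2≤hi hi≤hi′ , ch

  FanAtLeft : ℕ → ℕ → Set
  FanAtLeft i j = ∀ x → i < x → x ≤ j → Edge i x

  FanAtRight : ℕ → ℕ → Set
  FanAtRight i j = ∀ x → i ≤ x → x < j → Edge x j

  two-chord-in : ∀ {i j} → 2 + i ≤ j → Edge i j → TwoChordIn i j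
  two-chord-in {i} {j} = go j (m≤m+n j i)
    where
    go : ∀ fuel {i j} → j ≤ fuel + i → 2 + i ≤ j → Edge i j → TwoChordIn i j
    go zero j≤i i+2≤j _ = ⊥-elim (<⇒≱ (≤-trans (n≤1+n _) i+2≤j) j≤i)
    go (suc fuel) {i} {j} j≤fuel+i i+2≤j eij with triangle-apex i+2≤j eij
    ... | k , i<k , k<j , eik , ekj with 2 + i ≤? k
    ...   | yes i+2≤k = TwoChordIn-mono ≤-refl (<⇒≤ k<j)
                          (go fuel (≤-pred (≤-trans k<j j≤fuel+i)) i+2≤k eik)
    ...   | no i+2≰k with squeeze i<k i+2≰k
    ...     | refl with 2 + k ≤? j
    ...       | yes k+2≤j = TwoChordIn-mono (n≤1+n i) ≤-refl
                              (go fuel (subst (j ≤_) (sym (+-suc fuel i)) j≤fuel+i) k+2≤j ekj)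
    ...       | no k+2≰j with squeeze k<j k+2≰j
    ...         | refl = i , ≤-refl , ≤-refl , eij

  two-chord-or-fanʳ : ∀ {i j} → i < j → Edge i j → TwoChordIn i (pred j) ⊎ FanAtRight i j
  two-chord-or-fanʳ i<j = go (≤⇒≤‴ i<j)
    where
    go : ∀ {i j} → i <‴ j → Edge i j → TwoChordIn i (pred j) ⊎ FanAtRight i j
    go ≤‴-refl eij = inj₂ λ x i≤x x<j → subst (λ y → Edge y _) (≤-antisym i≤x (≤-pred x<j)) eij
    go {i} {j} (≤‴-step i+1<‴j) eij with triangle-apex (≤‴⇒≤ i+1<‴j) eij
    ... | k , i<k , k<j , eik , ekj with 2 + i ≤? k
    ...   | yes i+2≤k = inj₁ (TwoChordIn-mono ≤-refl (<⇒≤pred k<j) (two-chord-in i+2≤k eik))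
    ...   | no i+2≰k with squeeze i<k i+2≰k
    ...     | refl with go i+1<‴j ekj
    ...       | inj₁ ch = inj₁ (TwoChordIn-mono (n≤1+n i) ≤-refl ch)
    ...       | inj₂ fan = inj₂ fan′
      where
      fan′ : FanAtRight i j
      fan′ x i≤x x<j with i ≟ x
      ... | yes refl = eij
      ... | no i≢x = fan x (≤∧≢⇒< i≤x i≢x) x<j

  two-chord-or-fanˡ : ∀ {i j} → i < j → Edge i j → TwoChordIn (suc i) j ⊎ FanAtLeft i j
  two-chord-or-fanˡ i<j = go (≤⇒≤′ i<j)
    where
    go : ∀ {i j} → suc i ≤′ j → Edge i j → TwoChordIn (suc i) j ⊎ FanAtLeft i j
    go ≤′-refl eij = inj₂ λ x i<x x≤j → subst (Edge _) (≤-antisym i<x x≤j) eij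
    go {i} {suc j} (≤′-step i<′j) eij with triangle-apex (s≤s (≤′⇒≤ i<′j)) eij
    ... | k , i<k , k<j+1 , eik , ekj with 2 + k ≤? suc j
    ...   | yes k+2≤j+1 = inj₁ (TwoChordIn-mono i<k ≤-refl (two-chord-in k+2≤j+1 ekj))
    ...   | no k+2≰j+1 with squeeze k<j+1 k+2≰j+1
    ...     | refl with go i<′j eik
    ...       | inj₁ ch = inj₁ (TwoChordIn-mono ≤-refl (n≤1+n _) ch)
    ...       | inj₂ fan = inj₂ fan′
      where
      fan′ : FanAtLeft i (suc j)
      fan′ x i<x x≤j+1 with x ≟ suc j
      ... | yes refl = eij
      ... | no x≢j+1 = fan x i<x (≤-pred (≤∧≢⇒< x≤j+1 x≢j+1))

  Ear : ℕ → ℕ → ℕ → Set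
  Ear a b c = c < n × (∀ z → Edge c z → z ≡ a ⊎ z ≡ b)

  ear-under : ∀ {t} → TwoChordAt t → Ear t (2 + t) (suc t)
  ear-under {t} e = <-trans (n<1+n _) (target<n e) , nbrs
    where
    nbrs : ∀ z → Edge (suc t) z → z ≡ t ⊎ z ≡ 2 + t
    nbrs z ez with <-cmp z t
    ... | tri< z<t _ _ = ⊥-elim (no-crossing e ez (n<1+n t) (n<1+n _) (inj₁ z<t))
    ... | tri≈ _ z≡t _ = inj₁ z≡t
    ... | tri> _ _ t<z with <-cmp z (2 + t)
    ...   | tri≈ _ z≡t+2 _ = inj₂ z≡t+2
    ...   | tri> _ _ t+2<z = ⊥-elim (no-crossing e ez (n<1+n t) (n<1+n _) (inj₂ t+2<z))
    ...   | tri< z<t+2 _ _ with ≤-antisym (≤-pred z<t+2) t<z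
    ...     | refl = ⊥-elim (edge-irrefl ez)

  ear-last : ∀ {b} → suc b ≡ m → Edge 0 b → Ear 0 b m
  ear-last {b} b+1≡m e = ≤-refl , nbrs
    where
    b<m : b < m
    b<m = ≤-reflexive b+1≡m
    nbrs : ∀ z → Edge m z → z ≡ 0 ⊎ z ≡ b
    nbrs z ez with <-cmp z b
    ... | tri≈ _ z≡b _ = inj₂ z≡b
    ... | tri> _ _ b<z with ≤-antisym (≤-pred (target<n ez)) (subst (_≤ z) b+1≡m b<z)
    ...   | refl = ⊥-elim (edge-irrefl ez)
    nbrs zero ez | tri< _ _ _ = inj₁ refl
    nbrs (suc z) ez | tri< z<b _ _ = ⊥-elim (no-crossing e (edge-sym ez) (s≤s z≤n) z<b (inj₂ b<m))

  ear-first : Edge 1 m → Ear 1 m 0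
  ear-first e = s≤s z≤n , nbrs
    where
    nbrs : ∀ z → Edge 0 z → z ≡ 1 ⊎ z ≡ m
    nbrs zero ez = ⊥-elim (edge-irrefl ez)
    nbrs (suc zero) ez = inj₁ refl
    nbrs (suc (suc z)) ez with suc (suc z) ≟ m
    ... | yes z+2≡m = inj₂ z+2≡m
    ... | no z+2≢m = ⊥-elim (no-crossing e (edge-sym ez) (s≤s (s≤s z≤n))
                                (≤∧≢⇒< (≤-pred (target<n ez)) z+2≢m) (inj₁ (s≤s z≤n)))

  ear-across-closing-edge : ∀ {a b} → a < b → Edge a b → suc (b ∸ a) ≡ m → Σ ℕ (Ear a b)
  ear-across-closing-edge {zero} _ e b+1≡m = m , ear-last b+1≡m e
  ear-across-closing-edge {suc zero} {suc b} _ e b+1≡m =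
    0 , subst (λ x → Ear 1 x 0) (sym b+1≡m) (ear-first (subst (Edge 1) b+1≡m e))
  ear-across-closing-edge {suc (suc a)} {b} a+2<b e d+1≡m = ⊥-elim (<⇒≱ (m<m+n d z<s) d+a+1≤d)
    where
    d = b ∸ suc (suc a)
    d+a+2≤d+1 : d + suc (suc a) ≤ suc d
    d+a+2≤d+1 = subst₂ _≤_ (sym (m∸n+n≡m (<⇒≤ a+2<b))) (sym d+1≡m) (≤-pred (target<n e))
    d+a+1≤d : d + suc a ≤ d
    d+a+1≤d = ≤-pred (subst (_≤ suc d) (+-suc d (suc a)) d+a+2≤d+1)

  cdist-ordered : ∀ {a b} → a ≤ b → cdistℕ a b ≡ (b ∸ a) ⊓ (n ∸ (b ∸ a))
  cdist-ordered a≤b = cong (λ d → d ⊓ (n ∸ d)) (m≤n⇒∣m-n∣≡n∸m a≤b)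

  ear-of-ordered-two-chord : ∀ {a b} → a < b → Edge a b → (b ∸ a) ⊓ (n ∸ (b ∸ a)) ≡ 2 → Σ ℕ (Ear a b)
  ear-of-ordered-two-chord {a} {b} a<b e dist with ⊓-sel (b ∸ a) (n ∸ (b ∸ a))
  ... | inj₁ short = subst (λ x → Σ ℕ (Ear a x)) (sym b≡a+2) (suc a , ear-under (subst (Edge a) b≡a+2 e))
    where
    b≡a+2 : b ≡ 2 + a
    b≡a+2 = trans (sym (m∸n+n≡m (<⇒≤ a<b))) (cong (_+ a) (trans (sym short) dist))
  ... | inj₂ long = ear-across-closing-edge a<b e (suc-injective d+2≡n)
    where
    d+2≡n : 2 + (b ∸ a) ≡ n
    d+2≡n = trans (cong (_+ (b ∸ a)) (trans (sym dist) long))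
                  (m∸n+n≡m (≤-trans (m∸n≤m b a) (<⇒≤ (target<n e))))

  ear-of-two-chord : ∀ {a b} → Edge a b → cdistℕ a b ≡ 2 → Σ ℕ (Ear a b)
  ear-of-two-chord {a} {b} e dist with <-cmp a b
  ... | tri< a<b _ _ = ear-of-ordered-two-chord a<b e (trans (sym (cdist-ordered (<⇒≤ a<b))) dist)
  ... | tri≈ _ refl _ = ⊥-elim (edge-irrefl e)
  ... | tri> _ _ b<a with ear-of-ordered-two-chord b<a (edge-sym e) b-a-dist
    where
    b-a-dist = trans (sym (cdist-ordered (<⇒≤ b<a)))
                     (trans (cong (λ d → d ⊓ (n ∸ d)) (∣-∣-comm b a)) dist)
  ...   | c , c<n , nbrs = c , c<n , λ z → Data.Sum.swap ∘ nbrs z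

  two-chord-ear : ∀ {x y} → TwoChord G x y → Σ (Fin n) λ c → ∀ u → Adj G c u → u ≡ x ⊎ u ≡ y
  two-chord-ear (e , dist) with ear-of-two-chord (Adj⇒Edge e) dist
  ... | c , c<n , nbrs = fromℕ< c<n , λ u ecu →
    Data.Sum.map toℕ-injective toℕ-injective
      (nbrs (toℕ u) (subst (λ z → Edge z (toℕ u)) (toℕ-fromℕ< c<n) (Adj⇒Edge ecu)))

  Dominating : ℕ → Set
  Dominating h = h < n × (∀ x → x < n → x ≢ h → Edge h x)

  edge-avoiding-dominating : ∀ {h v w} → Dominating h → Edge v w → v ≢ h → w ≢ h → v < w →
                 w ≡ suc v ⊎ (v ≡ 0 × w ≡ m)
  edge-avoiding-dominating {h} {v} {w} (_ , spoke) evw v≢h w≢h v<w with suc v ≟ w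
  ... | yes refl = inj₁ refl
  ... | no v+1≢w with ≤∧≢⇒< v<w v+1≢w | <-cmp h v | <-cmp h w
  ...   | _ | tri≈ _ h≡v _ | _ = ⊥-elim (v≢h (sym h≡v))
  ...   | _ | _ | tri≈ _ h≡w _ = ⊥-elim (w≢h (sym h≡w))
  ...   | v+1<w | tri< h<v _ _ | _ =
    ⊥-elim (no-crossing evw (edge-sym (spoke (suc v) (<-trans v+1<w w<n) (<⇒≢ (m<n⇒m<1+n h<v) ∘ sym)))
                        (n<1+n v) v+1<w (inj₁ h<v))
    where w<n = target<n evw
  ...   | v+1<w | _ | tri> _ _ w<h =
    ⊥-elim (no-crossing evw (edge-sym (spoke (suc v) (<-trans v+1<w w<n) (<⇒≢ (<-trans v+1<w w<h))))
                        (n<1+n v) v+1<w (inj₂ w<h))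
    where w<n = target<n evw
  ...   | _ | tri> _ _ v<h | tri< h<w _ _ with suc w ≟ n
  ...     | no w+1≢n = ⊥-elim (no-crossing evw (spoke (suc w) (≤∧≢⇒< (target<n evw) w+1≢n)
                                                   (<⇒≢ (m<n⇒m<1+n h<w) ∘ sym))
                                             v<h h<w (inj₂ (n<1+n w)))
  ...     | yes refl with v
  ...       | zero = inj₂ (refl , refl)
  ...       | suc u = ⊥-elim (no-crossing evw (spoke u (<-trans (n<1+n u) (source<n evw))
                                                   (<⇒≢ (<-trans (n<1+n u) v<h)))
                                             v<h h<w (inj₁ (n<1+n u)))

  dominating⇒IsoFan : ∀ {h} → Dominating h → IsoFan G
  dominating⇒IsoFan {h} dom@(h<n , spoke) = rotation , λ v w → mk⇔ (forward v w) (backward v w)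
    where
    open Rotation h<n
    open ≡-Reasoning

    ρ : Fin n → Fin n
    ρ = Inverse.to rotation

    ρ-pos : ∀ v → toℕ v ≢ h → 1 ≤ toℕ (ρ v)
    ρ-pos v v≢h = subst (1 ≤_) (sym (toℕ-rotation v)) (shift-pos (toℕ<n v) v≢h)

    to-hub : ∀ v w → toℕ v ≡ h → toℕ w ≢ h → Hub (ρ v) (ρ w)
    to-hub v w v≡h w≢h = trans (toℕ-rotation v) (trans (cong shift v≡h) shift-h) , ρ-pos w w≢h

    to-path : ∀ v w → Edge (toℕ v) (toℕ w) → toℕ v ≢ h → toℕ w ≢ h → toℕ v < toℕ w →
              PathEdge (ρ v) (ρ w) ⊎ PathEdge (ρ w) (ρ v)
    to-path v w evw v≢h w≢h v<w with edge-avoiding-dominating dom evw v≢h w≢h v<w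
    ... | inj₁ w≡v+1 = inj₁ (ρ-pos v v≢h , (begin
      toℕ (ρ w)               ≡⟨ toℕ-rotation w ⟩
      shift (toℕ w)           ≡⟨ cong shift w≡v+1 ⟩
      shift (suc (toℕ v))     ≡⟨ shift-suc (w≢h ∘ trans w≡v+1) ⟩
      suc (shift (toℕ v))     ≡⟨ cong suc (toℕ-rotation v) ⟨
      suc (toℕ (ρ v))         ∎))
    ... | inj₂ (v≡0 , w≡m) = inj₂ (ρ-pos w w≢h , (begin
      toℕ (ρ v)               ≡⟨ toℕ-rotation v ⟩
      shift (toℕ v)           ≡⟨ cong shift v≡0 ⟩
      shift 0                 ≡⟨ shift-wrap refl (v≢h ∘ trans v≡0 ∘ sym) (w≢h ∘ trans w≡m ∘ sym) ⟩
      suc (shift m)           ≡⟨ cong (suc ∘ shift) w≡m ⟨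
      suc (shift (toℕ w))     ≡⟨ cong suc (toℕ-rotation w) ⟨
      suc (toℕ (ρ w))         ∎))

    forward : ∀ v w → Adj G v w → FanAdj (ρ v) (ρ w)
    forward v w e with toℕ v ≟ h | toℕ w ≟ h
    ... | yes v≡h | yes w≡h = ⊥-elim (edge-irrefl (subst₂ Edge v≡h w≡h (Adj⇒Edge e)))
    ... | yes v≡h | no w≢h = inj₁ (to-hub v w v≡h w≢h)
    ... | no v≢h | yes w≡h = inj₂ (inj₁ (to-hub w v w≡h v≢h))
    ... | no v≢h | no w≢h with <-cmp (toℕ v) (toℕ w)
    ...   | tri< v<w _ _ = inj₂ (inj₂ (to-path v w (Adj⇒Edge e) v≢h w≢h v<w))
    ...   | tri≈ _ v≡w _ = ⊥-elim (edge-irrefl (subst (Edge _) (sym v≡w) (Adj⇒Edge e)))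
    ...   | tri> _ _ w<v = inj₂ (inj₂ (Data.Sum.swap (to-path w v (edge-sym (Adj⇒Edge e)) w≢h v≢h w<v)))

    from-hub : ∀ v w → Hub (ρ v) (ρ w) → Edge (toℕ v) (toℕ w)
    from-hub v w (ρv≡0 , 1≤ρw) = subst (λ x → Edge x (toℕ w)) (sym v≡h) (spoke (toℕ w) (toℕ<n w) w≢h)
      where
      v≡h : toℕ v ≡ h
      v≡h = shift≡0⇒≡h (toℕ<n v) (trans (sym (toℕ-rotation v)) ρv≡0)
      w≢h : toℕ w ≢ h
      w≢h w≡h = <⇒≱ (subst (1 ≤_) (trans (toℕ-rotation w) (trans (cong shift w≡h) shift-h)) 1≤ρw) ≤-refl

    from-path : ∀ v w → PathEdge (ρ v) (ρ w) → Edge (toℕ v) (toℕ w)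
    from-path v w (_ , ρw≡ρv+1) with shift-suc⁻¹ (toℕ<n v) (toℕ<n w) shifted
      where
      shifted = trans (sym (toℕ-rotation w)) (trans ρw≡ρv+1 (cong suc (toℕ-rotation v)))
    ... | inj₁ w≡v+1 = subst (Edge _) (sym w≡v+1) (cycle-edge (subst (_< n) w≡v+1 (toℕ<n w)))
    ... | inj₂ (v+1≡n , w≡0) = subst₂ Edge (sym (suc-injective v+1≡n)) (sym w≡0) (edge-sym closing-edge)

    backward : ∀ v w → FanAdj (ρ v) (ρ w) → Adj G v w
    backward v w (inj₁ p) = Edge⇒Adj (from-hub v w p)
    backward v w (inj₂ (inj₁ p)) = Edge⇒Adj (edge-sym (from-hub w v p))
    backward v w (inj₂ (inj₂ (inj₁ p))) = Edge⇒Adj (from-path v w p)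
    backward v w (inj₂ (inj₂ (inj₂ p))) = Edge⇒Adj (edge-sym (from-path w v p))

module Dichotomy (k : ℕ) (G : MOP (7 + k)) where
  open Boundary G

  TwoChordℕ : ℕ → ℕ → Set
  TwoChordℕ a b = Edge a b × cdistℕ a b ≡ 2

  two-chords⇒independent : ∀ {a b c d} → TwoChordℕ a b → TwoChordℕ c d →
                           a ≢ c → a ≢ d → b ≢ c → b ≢ d → TwoIndependentTwoChords G
  two-chords⇒independent ((pa , pb , e) , dab) ((pc , pd , e′) , dcd) a≢c a≢d b≢c b≢d =
    fromℕ< pa , fromℕ< pb , fromℕ< pc , fromℕ< pd ,
    (e , trans (cdist-fromℕ< pa pb) dab) , (e′ , trans (cdist-fromℕ< pc pd) dcd) ,
    a≢c ∘ fromℕ<-injective _ _ pa pc , a≢d ∘ fromℕ<-injective _ _ pa pd ,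
    b≢c ∘ fromℕ<-injective _ _ pb pc , b≢d ∘ fromℕ<-injective _ _ pb pd

  TwoChordAt⇒TwoChordℕ : ∀ {t} → TwoChordAt t → TwoChordℕ t (2 + t)
  TwoChordAt⇒TwoChordℕ {t} e = e , distance
    where
    distance : cdistℕ t (2 + t) ≡ 2
    distance rewrite ∣m-n+m∣≡n t 2 = refl

  separated-two-chords : ∀ {t s} → 3 + t ≤ s → TwoChordAt t → TwoChordAt s → TwoIndependentTwoChords G
  separated-two-chords {t} {s} t+3≤s ct cs =
    two-chords⇒independent (TwoChordAt⇒TwoChordℕ ct) (TwoChordAt⇒TwoChordℕ cs)
      (<⇒≢ t<s) (<⇒≢ (<-trans t<s (m<n+m s z<s))) (<⇒≢ t+3≤s) (<⇒≢ (s≤s (s≤s t<s)))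
    where
    t<s : t < s
    t<s = ≤-trans (m≤n+m (suc t) 2) t+3≤s

  independent-with-chord-0-5+k : ∀ {t} → 1 ≤ t → 3 + t ≤ 5 + k → TwoChordAt t → Edge 0 (5 + k) →
                                 TwoIndependentTwoChords G
  independent-with-chord-0-5+k {t} 1≤t t+3≤5+k ct e =
    two-chords⇒independent (e , distance) (TwoChordAt⇒TwoChordℕ ct)
      (<⇒≢ 1≤t) (<⇒≢ (s≤s z≤n)) (<⇒≢ (≤-trans (m≤n+m (suc t) 2) t+3≤5+k) ∘ sym) (<⇒≢ t+3≤5+k ∘ sym)
    where
    distance : cdistℕ 0 (5 + k) ≡ 2
    distance rewrite m+n∸n≡m 2 k = refl

  independent-with-chord-1-6+k : ∀ {s} → 2 ≤ s → 3 + s ≤ 6 + k → TwoChordAt s → Edge 1 (6 + k) →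
                                 TwoIndependentTwoChords G
  independent-with-chord-1-6+k {s} 2≤s s+3≤6+k cs e =
    two-chords⇒independent (e , distance) (TwoChordAt⇒TwoChordℕ cs)
      (<⇒≢ 2≤s) (<⇒≢ (s≤s (s≤s z≤n))) (<⇒≢ (≤-trans (m≤n+m (suc s) 2) s+3≤6+k) ∘ sym) (<⇒≢ s+3≤6+k ∘ sym)
    where
    distance : cdistℕ 1 (6 + k) ≡ 2
    distance rewrite m+n∸n≡m 2 k = refl

  IndependentOrDominating : Set
  IndependentOrDominating = TwoIndependentTwoChords G ⊎ Σ ℕ Dominating

  chord-1-6+k⇒independent-or-dominating : Edge 1 (6 + k) → IndependentOrDominating
  chord-1-6+k⇒independent-or-dominating e with two-chord-or-fanˡ (s≤s (s≤s z≤n)) e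
  ... | inj₂ fan = inj₂ (1 , s≤s (s≤s z≤n) , spoke)
    where
    spoke : ∀ x → x < n → x ≢ 1 → Edge 1 x
    spoke zero _ _ = edge-sym (cycle-edge (s≤s (s≤s z≤n)))
    spoke (suc zero) _ x≢1 = ⊥-elim (x≢1 refl)
    spoke (suc (suc x)) x<n _ = fan _ (s≤s (s≤s z≤n)) (≤-pred x<n)
  ... | inj₁ (s , 2≤s , _ , cs) with 3 + s ≤? 6 + k
  ...   | yes s+3≤6+k = inj₁ (independent-with-chord-1-6+k 2≤s s+3≤6+k cs e)
  ...   | no s+3≰6+k with two-chord-or-fanʳ (s≤s (s≤s z≤n)) e
  ...     | inj₂ fan = inj₂ (6 + k , ≤-refl , spoke)
    where
    spoke : ∀ x → x < n → x ≢ 6 + k → Edge (6 + k) x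
    spoke zero _ _ = edge-sym closing-edge
    spoke (suc x) x<n x≢6+k = edge-sym (fan _ (s≤s z≤n) (≤∧≢⇒< (≤-pred x<n) x≢6+k))
  ...     | inj₁ (t , 1≤t , t+2≤5+k , ct) with 2 ≤? t
  ...       | yes 2≤t = inj₁ (independent-with-chord-1-6+k 2≤t (s≤s t+2≤5+k) ct e)
  ...       | no t≱2 with ≤-antisym (≤-pred (≰⇒> t≱2)) 1≤t
  ...         | refl = inj₁ (separated-two-chords 4≤s ct cs)
    where
    4≤s : 4 ≤ s
    4≤s = ≤-trans (m≤m+n 4 k) (≤-pred (≤-pred (≤-pred (≰⇒> s+3≰6+k))))

  chord-0-5+k⇒independent-or-dominating : Edge 0 (5 + k) → IndependentOrDominating
  chord-0-5+k⇒independent-or-dominating e with two-chord-or-fanʳ (s≤s z≤n) e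
  ... | inj₂ fan = inj₂ (5 + k , m<n⇒m<1+n (n<1+n _) , spoke)
    where
    spoke : ∀ x → x < n → x ≢ 5 + k → Edge (5 + k) x
    spoke x x<n x≢5+k with <-cmp x (5 + k)
    ... | tri< x<5+k _ _ = edge-sym (fan x z≤n x<5+k)
    ... | tri≈ _ x≡5+k _ = ⊥-elim (x≢5+k x≡5+k)
    ... | tri> _ _ 5+k<x with ≤-antisym (≤-pred x<n) 5+k<x
    ...   | refl = cycle-edge x<n
  ... | inj₁ (t , _ , t+2≤4+k , ct) with 1 ≤? t
  ...   | yes 1≤t = inj₁ (independent-with-chord-0-5+k 1≤t (s≤s t+2≤4+k) ct e)
  ...   | no t≱1 with ≤-antisym (≤-pred (≰⇒> t≱1)) z≤n
  ...     | refl with two-chord-or-fanˡ (s≤s z≤n) e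
  ...       | inj₂ fan = inj₂ (0 , s≤s z≤n , spoke)
    where
    spoke : ∀ x → x < n → x ≢ 0 → Edge 0 x
    spoke zero _ x≢0 = ⊥-elim (x≢0 refl)
    spoke (suc x) x<n _ with suc x ≟ 6 + k
    ... | yes refl = closing-edge
    ... | no x≢6+k = fan _ (s≤s z≤n) (≤-pred (≤∧≢⇒< (≤-pred x<n) x≢6+k))
  ...       | inj₁ (s , 1≤s , _ , cs) with 3 + s ≤? 5 + k
  ...         | yes s+3≤5+k = inj₁ (independent-with-chord-0-5+k 1≤s s+3≤5+k cs e)
  ...         | no s+3≰5+k = inj₁ (separated-two-chords 3≤s ct cs)
    where
    3≤s : 3 ≤ s
    3≤s = ≤-trans (m≤m+n 3 k) (≤-pred (≤-pred (≤-pred (≰⇒> s+3≰5+k))))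

  triangle⇒independent-or-dominating : ∀ {c} → 2 ≤ c → 2 + c ≤ 6 + k → Edge 0 c → Edge c (6 + k) →
                                       IndependentOrDominating
  triangle⇒independent-or-dominating {c} 2≤c@(s≤s (s≤s _)) c+2≤6+k e0c ecm
    with two-chord-or-fanʳ (s≤s z≤n) e0c | two-chord-or-fanˡ (≤-trans (n≤1+n _) c+2≤6+k) ecm
  ... | inj₁ (t , _ , t+2≤c-1 , ct) | _ =
    let s , c≤s , _ , cs = two-chord-in c+2≤6+k ecm
    in inj₁ (separated-two-chords (≤-trans (s≤s t+2≤c-1) c≤s) ct cs)
  ... | _ | inj₁ (s , c<s , _ , cs) =
    let t , _ , t+2≤c , ct = two-chord-in 2≤c e0c
    in inj₁ (separated-two-chords (≤-trans (s≤s t+2≤c) c<s) ct cs)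
  ... | inj₂ fanʳ | inj₂ fanˡ = inj₂ (c , target<n e0c , spoke)
    where
    spoke : ∀ x → x < n → x ≢ c → Edge c x
    spoke x x<n x≢c with <-cmp x c
    ... | tri< x<c _ _ = edge-sym (fanʳ x z≤n x<c)
    ... | tri≈ _ x≡c _ = ⊥-elim (x≢c x≡c)
    ... | tri> _ _ c<x = fanˡ x c<x (≤-pred x<n)

  independent-or-dominating : IndependentOrDominating
  independent-or-dominating with triangle-apex (s≤s (s≤s z≤n)) closing-edge
  ... | c , 0<c , c<6+k , e0c , ecm with c ≟ 1 | c ≟ 5 + k
  ...   | yes refl | _ = chord-1-6+k⇒independent-or-dominating ecm
  ...   | _ | yes refl = chord-0-5+k⇒independent-or-dominating e0c
  ...   | no c≢1 | no c≢5+k =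
    triangle⇒independent-or-dominating (≤∧≢⇒< 0<c (c≢1 ∘ sym)) (≤∧≢⇒< c<6+k c≢5+k′) e0c ecm
    where c≢5+k′ = λ eq → c≢5+k (suc-injective eq)

  module FanCentre (iso : IsoFan G) where
    open Inverse (proj₁ iso)

    centre : Fin n
    centre = from Fin.zero

    fan→adj : ∀ v w → FanAdj (to v) (to w) → Adj G v w
    fan→adj v w = Equivalence.from (proj₂ iso v w)

    centre-on-two-chord : ∀ {x y} → TwoChord G x y → centre ≡ x ⊎ centre ≡ y
    centre-on-two-chord {x} {y} ch with two-chord-ear ch
    ... | c , nbrs with toℕ (to c) ≟ 0
    ...   | no to-c≢0 =
      nbrs centre (fan→adj c centre (inj₂ (inj₁ (to-centre , n≢0⇒n>0 to-c≢0))))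
      where to-centre = cong toℕ (strictlyInverseˡ Fin.zero)
    -- the ear cannot be the centre, which has a neighbour other than x and y
    ...   | yes to-c≡0 with avoid-two (to x) (to y)
    ...     | u , 1≤u , u≢x , u≢y with nbrs (from u) (fan→adj c (from u) (inj₁ (to-c≡0 , 1≤u′)))
      where 1≤u′ = subst (λ v → 1 ≤ toℕ v) (sym (strictlyInverseˡ u)) 1≤u
    ...       | inj₁ u′≡x = ⊥-elim (u≢x (trans (sym (strictlyInverseˡ u)) (cong to u′≡x)))
    ...       | inj₂ u′≡y = ⊥-elim (u≢y (trans (sym (strictlyInverseˡ u)) (cong to u′≡y)))

  not-both : TwoIndependentTwoChords G × IsoFan G → ⊥
  not-both ((a , b , c , d , ab , cd , a≢c , a≢d , b≢c , b≢d) , iso) =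
    disjoint (centre-on-two-chord ab) (centre-on-two-chord cd)
    where
    open FanCentre iso
    disjoint : centre ≡ a ⊎ centre ≡ b → centre ≡ c ⊎ centre ≡ d → ⊥
    disjoint (inj₁ p) (inj₁ q) = a≢c (trans (sym p) q)
    disjoint (inj₁ p) (inj₂ q) = a≢d (trans (sym p) q)
    disjoint (inj₂ p) (inj₁ q) = b≢c (trans (sym p) q)
    disjoint (inj₂ p) (inj₂ q) = b≢d (trans (sym p) q)

lemma10 : (n : ℕ) → 7 ≤ n → (G : MOP n) →
    (TwoIndependentTwoChords G ⊎ IsoFan G) × ¬ (TwoIndependentTwoChords G × IsoFan G)
lemma10 n 7≤n G with m≤n⇒∃[o]m+o≡n 7≤n
... | k , refl = Data.Sum.map₂ (dominating⇒IsoFan ∘ proj₂) independent-or-dominating , not-both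
  where
  open Boundary G using (dominating⇒IsoFan)
  open Dichotomy k G using (independent-or-dominating; not-both)
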